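{- For every diagram $D$, \[\mathrm{mc}(D)=|\mathrm{empty}(D)|-\max_{\widehat D\in\mathrm{Min}(D)}|\mathrm{empty}(\widehat D)|.\]
   Context: A diagram is a finite subset $D\subset\mathbb{Z}_{>0}\times\mathbb{Z}_{>0}$; $(r,c)\in D$ is a cell in row $r$, column $c$. $\mathrm{empty}(D)=\{(r,c)\notin D : \exists\,\tilde r>r \text{ with } (\tilde r,c)\in D\}$. Kohnert move at row $r$: if row $r$ is empty, $\mathcal{K}(D,r)=D$; otherwise let $(r,c)$ be the rightmost cell of row $r$; if some $r'<r$ has $(r',c)\notin D$, take the largest such $r'$ and set $\mathcal{K}(D,r)=(D\setminus\{(r,c)\})\cup\{(r',c)\}$; else $\mathcal{K}(D,r)=D$. A move is nontrivial if $\mathcal{K}(D,r)\ne D$. $\mathrm{KD}(D)$ is the set of diagrams obtainable from $D$ by finite sequences of Kohnert moves, and $\mathrm{Min}(D)=\{\tilde D\in\mathrm{KD}(D):\mathcal{K}(\tilde D,r)=\tilde D\ \forall r\}$. $\mathrm{mc}(D)$ is the minimum, over all $\tilde D\in\mathrm{Min}(D)$ and all sequences of nontrivial Kohnert moves transforming $D$ into $\tilde D$, of the number of moves. -}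

module Defs where

open import Data.Nat using (ℕ; zero; suc; _+_; _≤_; _<_; _≟_)
open import Data.Bool using (Bool; true; false; not; _∧_; if_then_else_)
open import Data.List using (List; []; _∷_; map; applyUpTo; length; filter)
open import Data.Bool.ListAction using (any)
open import Data.Nat.ListAction using (sum)
open import Data.Product using (Σ; ∃; _×_; _,_)
open import Relation.Nullary using (¬_; Dec; yes; no)
open import Relation.Nullary.Decidable using (⌊_⌋)
open import Relation.Binary.PropositionalEquality using (_≡_)

-- A diagram: a finite set of cells (r , c) with r, c ≥ 1, given by its
-- (Boolean) membership predicate together with a bound N such that every
-- cell lies in [1..N] × [1..N].  Two diagrams are equal as sets iff their
-- membership predicates agree pointwise (_≈_ below).
record Diagram : Set where
  field
    cell    : ℕ → ℕ → Bool
    bound   : ℕ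
    bounded : ∀ r c → cell r c ≡ true → (1 ≤ r × r ≤ bound) × (1 ≤ c × c ≤ bound)
open Diagram public

_≈_ : Diagram → Diagram → Set
D ≈ E = ∀ r c → cell D r c ≡ cell E r c

range : ℕ → ℕ → List ℕ
range a b = applyUpTo (λ i → a + i) (suc b Data.Nat.∸ a)

-- (r , c) ∈ empty(D): (r , c) ∉ D and some (r̃ , c) ∈ D with r̃ > r
-- (any such r̃ is ≤ bound D).
inEmpty : Diagram → ℕ → ℕ → Bool
inEmpty D r c = not (cell D r c) ∧ any (λ r̃ → cell D r̃ c) (range (suc r) (bound D))

-- |empty(D)|: all cells of empty(D) have 1 ≤ r, c ≤ bound D
emptyCount : Diagram → ℕ
emptyCount D =
  sum (map (λ r → length (filter (λ c → inEmpty D r c Data.Bool.≟ true) (range 1 (bound D))))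
           (range 1 (bound D)))

-- Conditions under which the Kohnert move at row r is nontrivial:
-- (r , c) is the rightmost cell of row r, and r' is the largest row
-- index r' < r (r' ≥ 1) with (r' , c) ∉ D.
NontrivialAt : Diagram → (r c r' : ℕ) → Set
NontrivialAt D r c r' =
    cell D r c ≡ true
  × (∀ c' → c < c' → cell D r c' ≡ false)
  × 1 ≤ r' × r' < r
  × cell D r' c ≡ false
  × (∀ r'' → r' < r'' → r'' < r → cell D r'' c ≡ true)

movedCell : Diagram → (r c r' : ℕ) → ℕ → ℕ → Bool
movedCell D r c r' x y =
  if ⌊ x ≟ r ⌋ ∧ ⌊ y ≟ c ⌋ then false
  else if ⌊ x ≟ r' ⌋ ∧ ⌊ y ≟ c ⌋ then true
  else cell D x y

Move : Diagram → ℕ → Diagram → Set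
Move D r E = Σ ℕ λ c → Σ ℕ λ r' →
  NontrivialAt D r c r' × (∀ x y → cell E x y ≡ movedCell D r c r' x y)

data Steps : Diagram → Diagram → ℕ → Set where
  done : ∀ {D E} → D ≈ E → Steps D E 0
  step : ∀ {D E F k} (r : ℕ) → Move D r E → Steps E F k → Steps D F (suc k)

-- E ∈ KD(D)  (trivial moves do not change the diagram, so it suffices to
-- use sequences of nontrivial moves)
InKD : Diagram → Diagram → Set
InKD D E = ∃ λ k → Steps D E k

-- 𝒦(D, r) = D for every row r  (row index 0 is not a row; it is harmless)
Fixed : Diagram → Set
Fixed D = ∀ r c r' → ¬ NontrivialAt D r c r'

InMin : Diagram → Diagram → Set
InMin D E = InKD D E × Fixed E

IsMC : Diagram → ℕ → Set
IsMC D m =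
    (Σ Diagram λ E → Fixed E × Steps D E m)
  × (∀ E k → Fixed E → Steps D E k → m ≤ k)

IsMaxEmptyMin : Diagram → ℕ → Set
IsMaxEmptyMin D M =
    (Σ Diagram λ E → InMin D E × emptyCount E ≡ M)
  × (∀ E → InMin D E → emptyCount E ≤ M)

-- Let h(D) count the positions (x, c) such that column c of D has a cell in row x or
-- higher, i.e. h(D) is the sum of the column heights. Each such position is either a cell
-- or an empty position, so |empty(D)| = h(D) − |D|. A Kohnert move preserves every column
-- size and lowers h by at most one, and by exactly one when the moved cell is the top of
-- its column, as happens for a move at the highest row admitting a nontrivial move.
-- Making such highest moves until none is left therefore reaches some G ∈ Min(D) after
-- |empty(D)| − |empty(G)| moves, while reaching any E ∈ Min(D) takes at least
-- |empty(D)| − |empty(E)| moves. It remains to show |empty(E)| ≤ |empty(G)|. Along the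
-- greedy path, E stays below the current diagram B: same column sizes, and no column of E
-- is higher than in B. This persists because, E being fixed, every column of E is full
-- below the rightmost cell of each row, so E cannot occupy the position that a highest
-- move vacates.
module Submission where

open import Defs
open import Data.Bool using (Bool; true; false; not; _∧_; _∨_; T)
open import Data.Bool.Properties using (⇔→≡; T-≡; ¬-not; not-¬; ∧-zeroʳ; ∨-zeroʳ)
open import Data.Bool.ListAction using (any)
open import Data.Empty using (⊥)
open import Data.List using ([]; _∷_; map; applyUpTo; length; filter)
open import Data.List.Relation.Unary.Any.Properties using (any⁺; any⁻; applyUpTo⁺; applyUpTo⁻)
open import Data.Nat using (ℕ; zero; suc; _+_; _*_; _∸_; _≤_; _<_; z≤n; s≤s; z<s; s<s; _≟_; _≤?_)
open import Data.Nat.ListAction using (sum)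
open import Data.Nat.Properties
open import Algebra.Properties.CommutativeSemigroup +-commutativeSemigroup using (interchange)
open import Data.Product using (∃; ∃₂; _×_; _,_; proj₁; proj₂)
open import Data.Sum using (_⊎_; inj₁; inj₂; [_,_]′)
open import Function using (_∘_; case_of_; Equivalence; mk⇔)
open import Relation.Binary.Definitions using (tri<; tri≈; tri>)
open import Relation.Binary.PropositionalEquality
open import Relation.Nullary using (¬_; does; yes; no; contradiction; _×-dec_)
open import Relation.Nullary.Decidable using (⌊_⌋; dec-true; dec-false)
open import Relation.Unary using (Decidable)

-- Finite sums and counts

𝟙 : Bool → ℕ
𝟙 true  = 1
𝟙 false = 0

𝟙-mono : ∀ {a b} → (a ≡ true → b ≡ true) → 𝟙 a ≤ 𝟙 b
𝟙-mono {false} _   = z≤n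
𝟙-mono {true}  a⇒b rewrite a⇒b refl = ≤-refl

𝟙≤1 : ∀ b → 𝟙 b ≤ 1
𝟙≤1 true  = ≤-refl
𝟙≤1 false = z≤n

𝟙-false : ∀ {b} → b ≢ true → 𝟙 b ≡ 0
𝟙-false {false} _      = refl
𝟙-false {true}  b≢true = contradiction refl b≢true

∑< : ℕ → (ℕ → ℕ) → ℕ
∑< zero    f = 0
∑< (suc n) f = f 0 + ∑< n (f ∘ suc)

syntax ∑< n (λ i → e) = ∑[ i < n ] e

∑-cong : ∀ n {f g : ℕ → ℕ} → (∀ i → i < n → f i ≡ g i) → ∑< n f ≡ ∑< n g
∑-cong zero    f≡g = refl
∑-cong (suc n) f≡g = cong₂ _+_ (f≡g 0 z<s) (∑-cong n (λ i i<n → f≡g (suc i) (s<s i<n)))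

∑-mono : ∀ n {f g : ℕ → ℕ} → (∀ i → i < n → f i ≤ g i) → ∑< n f ≤ ∑< n g
∑-mono zero    f≤g = z≤n
∑-mono (suc n) f≤g = +-mono-≤ (f≤g 0 z<s) (∑-mono n (λ i i<n → f≤g (suc i) (s<s i<n)))

∑-zero : ∀ n {f : ℕ → ℕ} → (∀ i → f i ≡ 0) → ∑< n f ≡ 0
∑-zero zero    f≡0 = refl
∑-zero (suc n) f≡0 = cong₂ _+_ (f≡0 0) (∑-zero n (f≡0 ∘ suc))

∑-extend : ∀ {N K} {f : ℕ → ℕ} → (∀ i → N ≤ i → f i ≡ 0) → N ≤ K →
  ∑< K f ≡ ∑< N f
∑-extend {zero}  {K}         f≡0 _          = ∑-zero K (λ i → f≡0 i z≤n)
∑-extend {suc N} {suc K} {f} f≡0 (s≤s N≤K) =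
  cong (f 0 +_) (∑-extend (λ i N≤i → f≡0 (suc i) (s≤s N≤i)) N≤K)

∑-distrib-+ : ∀ n (f g : ℕ → ℕ) → ∑[ i < n ] (f i + g i) ≡ ∑< n f + ∑< n g
∑-distrib-+ zero    f g = refl
∑-distrib-+ (suc n) f g =
  trans (cong (f 0 + g 0 +_) (∑-distrib-+ n _ _)) (interchange (f 0) (g 0) _ _)

∑-distrib-*ʳ : ∀ n (f : ℕ → ℕ) m → ∑[ i < n ] (f i * m) ≡ ∑< n f * m
∑-distrib-*ʳ zero    f m = refl
∑-distrib-*ʳ (suc n) f m =
  trans (cong (f 0 * m +_) (∑-distrib-*ʳ n _ m)) (sym (*-distribʳ-+ m (f 0) _))

∑-comm : ∀ n m (f : ℕ → ℕ → ℕ) →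
  ∑[ i < n ] ∑[ j < m ] f i j ≡ ∑[ j < m ] ∑[ i < n ] f i j
∑-comm zero    m f = sym (∑-zero m (λ _ → refl))
∑-comm (suc n) m f =
  trans (cong (∑< m (f 0) +_) (∑-comm n m (f ∘ suc))) (sym (∑-distrib-+ m (f 0) _))

∑-𝟙-∧ : ∀ b n (g : ℕ → Bool) → ∑[ j < n ] 𝟙 (b ∧ g j) ≡ 𝟙 b * ∑[ j < n ] 𝟙 (g j)
∑-𝟙-∧ true  n g = sym (+-identityʳ _)
∑-𝟙-∧ false n g = ∑-zero n (λ _ → refl)

-- Indicators of index tests use `does`, not ⌊_⌋: does (suc i ≟ suc k) computes to
-- does (i ≟ k), as the next three inductions need, but `with` cannot abstract over it,
-- so pointwise proofs evaluate such indicators with dec-true and dec-false.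
∑-𝟙-≟-≤ : ∀ n k → ∑[ i < n ] 𝟙 (does (suc i ≟ k)) ≤ 1
∑-𝟙-≟-≤ n       zero          = ≤-trans (≤-reflexive (∑-zero n (λ _ → refl))) z≤n
∑-𝟙-≟-≤ zero    (suc k)       = z≤n
∑-𝟙-≟-≤ (suc n) (suc zero)    = ≤-reflexive (cong suc (∑-zero n (λ _ → refl)))
∑-𝟙-≟-≤ (suc n) (suc (suc k)) = ∑-𝟙-≟-≤ n (suc k)

∑-𝟙-≟ : ∀ {n k} → 1 ≤ k → k ≤ n → ∑[ i < n ] 𝟙 (does (suc i ≟ k)) ≡ 1
∑-𝟙-≟ {suc n} {suc zero}    _ _         = cong suc (∑-zero n (λ _ → refl))
∑-𝟙-≟ {suc n} {suc (suc k)} _ (s≤s k<n) = ∑-𝟙-≟ (s≤s z≤n) k<n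

∑-𝟙-≤? : ∀ {n k} → k ≤ n → ∑[ i < n ] 𝟙 (does (suc i ≤? k)) ≡ k
∑-𝟙-≤? {n}     {zero}  _         = ∑-zero n (λ _ → refl)
∑-𝟙-≤? {suc n} {suc k} (s≤s k≤n) = cong suc (∑-𝟙-≤? k≤n)

count : ℕ → (ℕ → ℕ → Bool) → ℕ
count K P = ∑[ i < K ] ∑[ j < K ] 𝟙 (P (suc i) (suc j))

count-mono : ∀ K {P Q : ℕ → ℕ → Bool} → (∀ {x y} → P x y ≡ true → Q x y ≡ true) →
  count K P ≤ count K Q
count-mono K P⇒Q = ∑-mono K (λ i _ → ∑-mono K (λ j _ → 𝟙-mono P⇒Q))

count-+ : ∀ K (P Q : ℕ → ℕ → Bool) →
  count K P + count K Q ≡ ∑[ i < K ] ∑[ j < K ] (𝟙 (P (suc i) (suc j)) + 𝟙 (Q (suc i) (suc j)))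
count-+ K P Q = sym (trans (∑-cong K (λ i _ → ∑-distrib-+ K _ _)) (∑-distrib-+ K _ _))

count-merge : ∀ K {P Q R : ℕ → ℕ → Bool} →
  (∀ x y → 𝟙 (P x y) + 𝟙 (Q x y) ≡ 𝟙 (R x y)) → count K P + count K Q ≡ count K R
count-merge K {P} {Q} merge =
  trans (count-+ K P Q) (∑-cong K (λ i _ → ∑-cong K (λ j _ → merge (suc i) (suc j))))

count-≤-+ : ∀ K {P Q R : ℕ → ℕ → Bool} →
  (∀ x y → 𝟙 (R x y) ≤ 𝟙 (P x y) + 𝟙 (Q x y)) → count K R ≤ count K P + count K Q
count-≤-+ K {P} {Q} split = ≤-trans
  (∑-mono K (λ i _ → ∑-mono K (λ j _ → split (suc i) (suc j))))
  (≤-reflexive (sym (count-+ K P Q)))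

count-support : ∀ {N K} {P : ℕ → ℕ → Bool} →
  (∀ {x y} → P x y ≡ true → x ≤ N × y ≤ N) → N ≤ K → count K P ≡ count N P
count-support {N} {K} support N≤K = trans
  (∑-cong K (λ i _ → ∑-extend (λ j N≤j → 𝟙-false (λ e → <⇒≱ (proj₂ (support e)) N≤j)) N≤K))
  (∑-extend (λ i N≤i → ∑-zero N (λ j → 𝟙-false (λ e → <⇒≱ (proj₁ (support e)) N≤i))) N≤K)

isCell : ℕ → ℕ → ℕ → ℕ → Bool
isCell r c x y = does (x ≟ r) ∧ does (y ≟ c)

isCell-self : ∀ r c → isCell r c r c ≡ true
isCell-self r c = cong₂ _∧_ (dec-true (r ≟ r) refl) (dec-true (c ≟ c) refl)

isCell-elsewhere : ∀ {r c x y} → ¬ (x ≡ r × y ≡ c) → isCell r c x y ≡ false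
isCell-elsewhere {r} {c} {x} {y} ¬rc with x ≟ r
... | no x≢r  = cong (_∧ does (y ≟ c)) (dec-false (x ≟ r) x≢r)
... | yes x≡r =
  trans (cong (does (x ≟ r) ∧_) (dec-false (y ≟ c) (λ y≡c → ¬rc (x≡r , y≡c)))) (∧-zeroʳ _)

count-isCell : ∀ K r c →
  count K (isCell r c) ≡ ∑[ i < K ] 𝟙 (does (suc i ≟ r)) * ∑[ j < K ] 𝟙 (does (suc j ≟ c))
count-isCell K r c =
  trans (∑-cong K (λ i _ → ∑-𝟙-∧ (does (suc i ≟ r)) K _)) (∑-distrib-*ʳ K _ _)

count-isCell-≤ : ∀ K r c → count K (isCell r c) ≤ 1
count-isCell-≤ K r c =
  ≤-trans (≤-reflexive (count-isCell K r c)) (*-mono-≤ (∑-𝟙-≟-≤ K r) (∑-𝟙-≟-≤ K c))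

count-isCell-≡ : ∀ {K r c} → 1 ≤ r → r ≤ K → 1 ≤ c → c ≤ K → count K (isCell r c) ≡ 1
count-isCell-≡ {K} {r} {c} 1≤r r≤K 1≤c c≤K =
  trans (count-isCell K r c) (cong₂ _*_ (∑-𝟙-≟ 1≤r r≤K) (∑-𝟙-≟ 1≤c c≤K))

-- Empty cells, column heights and column sizes

sum-map-applyUpTo : ∀ n (f h : ℕ → ℕ) → sum (map h (applyUpTo f n)) ≡ ∑[ i < n ] h (f i)
sum-map-applyUpTo zero    f h = refl
sum-map-applyUpTo (suc n) f h = cong (h (f 0) +_) (sum-map-applyUpTo n (f ∘ suc) h)

length-filter-≡true : ∀ (p : ℕ → Bool) xs →
  length (filter (λ x → p x Data.Bool.≟ true) xs) ≡ sum (map (𝟙 ∘ p) xs)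
length-filter-≡true p []       = refl
length-filter-≡true p (x ∷ xs) with p x
... | true  = cong suc (length-filter-≡true p xs)
... | false = length-filter-≡true p xs

emptyCount-count : ∀ D → emptyCount D ≡ count (bound D) (inEmpty D)
emptyCount-count D = trans (sum-map-applyUpTo (bound D) suc _) (∑-cong (bound D) λ i _ →
  trans (length-filter-≡true (inEmpty D (suc i)) (applyUpTo suc (bound D)))
        (sum-map-applyUpTo (bound D) suc (𝟙 ∘ inEmpty D (suc i))))

range-bounds : ∀ a N {i} → i < suc N ∸ a → a + i ≤ N
range-bounds zero    N           i<N+1 = ≤-pred i<N+1
range-bounds (suc a) zero    {i} i<0   = contradiction (subst (i <_) (0∸n≡0 a) i<0) λ ()
range-bounds (suc a) (suc N)     i<    = s≤s (range-bounds a N i<)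

any-range⁻ : ∀ (p : ℕ → Bool) {a N} → any p (range a N) ≡ true →
  ∃ λ y → a ≤ y × y ≤ N × p y ≡ true
any-range⁻ p {a} {N} any≡true
  with i , i< , pi ← applyUpTo⁻ (a +_) (any⁻ p _ (Equivalence.from T-≡ any≡true))
  = a + i , m≤m+n a i , range-bounds a N i< , Equivalence.to T-≡ pi

any-range⁺ : ∀ (p : ℕ → Bool) {a N y} → a ≤ y → y ≤ N → p y ≡ true → any p (range a N) ≡ true
any-range⁺ p {a} a≤y y≤N py = Equivalence.to T-≡ (any⁺ p (applyUpTo⁺ (a +_)
  (subst (T ∘ p) (sym (m+[n∸m]≡n a≤y)) (Equivalence.from T-≡ py))
  (∸-monoˡ-< (s≤s y≤N) a≤y)))

module _ (D : Diagram) {r c : ℕ} (rc∈D : cell D r c ≡ true) where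
  row≤bound : r ≤ bound D
  row≤bound = proj₂ (proj₁ (bounded D r c rc∈D))

  col≤bound : c ≤ bound D
  col≤bound = proj₂ (proj₂ (bounded D r c rc∈D))

  1≤col : 1 ≤ c
  1≤col = proj₁ (proj₂ (bounded D r c rc∈D))

Reaches : Diagram → ℕ → ℕ → Set
Reaches D x c = ∃ λ y → x ≤ y × cell D y c ≡ true

above : Diagram → ℕ → ℕ → Bool
above D x c = any (λ y → cell D y c) (range (suc x) (bound D))

-- Since inEmpty D x c = not (cell D x c) ∧ above D x c, each position counted by
-- reaches? is either a cell or an empty position.
reaches? : Diagram → ℕ → ℕ → Bool
reaches? D x c = cell D x c ∨ above D x c

above-sound : ∀ D {x c} → above D x c ≡ true → ∃ λ y → x < y × cell D y c ≡ true
above-sound D {x} {c} e with y , x<y , _ , y∈D ← any-range⁻ (λ y → cell D y c) e = y , x<y , y∈D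

reaches?-sound : ∀ D x c → reaches? D x c ≡ true → Reaches D x c
reaches?-sound D x c e with cell D x c in x∈D
... | true  = x , ≤-refl , x∈D
... | false with y , x<y , y∈D ← above-sound D e = y , <⇒≤ x<y , y∈D

reaches?-complete : ∀ D {x c} → Reaches D x c → reaches? D x c ≡ true
reaches?-complete D {x} {c} (y , x≤y , y∈D) with m≤n⇒m<n∨m≡n x≤y
... | inj₂ refl rewrite y∈D = refl
... | inj₁ x<y
  rewrite any-range⁺ (λ y → cell D y c) x<y (row≤bound D y∈D) y∈D = ∨-zeroʳ _

inEmpty-bounded : ∀ D {x c} → inEmpty D x c ≡ true → x ≤ bound D × c ≤ bound D
inEmpty-bounded D {x} {c} e with cell D x c
... | true  = contradiction e λ ()
... | false with y , x<y , y∈D ← above-sound D e =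
  ≤-trans (<⇒≤ x<y) (row≤bound D y∈D) , col≤bound D y∈D

𝟙-not∧-+ : ∀ a b → 𝟙 (not a ∧ b) + 𝟙 a ≡ 𝟙 (a ∨ b)
𝟙-not∧-+ true  b = refl
𝟙-not∧-+ false b = +-identityʳ (𝟙 b)

emptyCount-+-cells : ∀ D {K} → bound D ≤ K →
  emptyCount D + count K (cell D) ≡ count K (reaches? D)
emptyCount-+-cells D {K} D≤K = begin
  emptyCount D + count K (cell D)
    ≡⟨ cong (_+ count K (cell D)) (emptyCount-count D) ⟩
  count (bound D) (inEmpty D) + count K (cell D)
    ≡⟨ cong (_+ count K (cell D)) (count-support (inEmpty-bounded D) D≤K) ⟨
  count K (inEmpty D) + count K (cell D)
    ≡⟨ count-merge K {inEmpty D} {cell D} (λ x c → 𝟙-not∧-+ (cell D x c) (above D x c)) ⟩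
  count K (reaches? D) ∎
  where open ≡-Reasoning

columnSize : Diagram → ℕ → ℕ
columnSize D c = ∑[ i < bound D ] 𝟙 (cell D (suc i) c)

columnSize-extend : ∀ D {K} c → bound D ≤ K →
  ∑[ i < K ] 𝟙 (cell D (suc i) c) ≡ columnSize D c
columnSize-extend D c D≤K = ∑-extend (λ i D≤i → 𝟙-false (λ e → <⇒≱ (row≤bound D e) D≤i)) D≤K

count-cells : ∀ D {K} → bound D ≤ K → count K (cell D) ≡ ∑[ j < K ] columnSize D (suc j)
count-cells D {K} D≤K =
  trans (∑-comm K K _) (∑-cong K (λ j _ → columnSize-extend D (suc j) D≤K))

r≤columnSize : ∀ D {r c} → (∀ {x} → 1 ≤ x → x ≤ r → cell D x c ≡ true) → r ≤ columnSize D c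
r≤columnSize D {r} {c} full = begin
  r                                ≡⟨ ∑-𝟙-≤? (m≤n+m r (bound D)) ⟨
  ∑[ i < K ] 𝟙 (does (suc i ≤? r)) ≤⟨ ∑-mono K (λ i _ → below-r (suc i) (s≤s z≤n)) ⟩
  ∑[ i < K ] 𝟙 (cell D (suc i) c)  ≡⟨ columnSize-extend D c (m≤m+n (bound D) r) ⟩
  columnSize D c                   ∎
  where
  open ≤-Reasoning
  K = bound D + r
  below-r : ∀ x → 1 ≤ x → 𝟙 (does (x ≤? r)) ≤ 𝟙 (cell D x c)
  below-r x 1≤x with x ≤? r
  ... | yes x≤r rewrite dec-true (x ≤? r) x≤r | full 1≤x x≤r = ≤-refl
  ... | no x≰r  rewrite dec-false (x ≤? r) x≰r = z≤n

columnSize<r : ∀ D {r r' c} → (∀ {y} → r < y → cell D y c ≡ false) →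
  1 ≤ r' → r' ≤ r → cell D r' c ≡ false → columnSize D c < r
columnSize<r D {r} {r'} {c} top 1≤r' r'≤r hole = begin
  suc (columnSize D c)
    ≡⟨ +-comm 1 _ ⟩
  columnSize D c + 1
    ≡⟨ cong₂ _+_ (columnSize-extend D c K≥D) (∑-𝟙-≟ 1≤r' (≤-trans r'≤r K≥r)) ⟨
  ∑[ i < K ] 𝟙 (cell D (suc i) c) + ∑[ i < K ] 𝟙 (does (suc i ≟ r'))
    ≡⟨ ∑-distrib-+ K (λ i → 𝟙 (cell D (suc i) c)) _ ⟨
  ∑[ i < K ] (𝟙 (cell D (suc i) c) + 𝟙 (does (suc i ≟ r')))
    ≤⟨ ∑-mono K (λ i _ → column (suc i)) ⟩
  ∑[ i < K ] 𝟙 (does (suc i ≤? r))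
    ≡⟨ ∑-𝟙-≤? K≥r ⟩
  r ∎
  where
  open ≤-Reasoning
  K = bound D + r
  K≥D = m≤m+n (bound D) r
  K≥r = m≤n+m r (bound D)
  column : ∀ x → 𝟙 (cell D x c) + 𝟙 (does (x ≟ r')) ≤ 𝟙 (does (x ≤? r))
  column x with x ≟ r' | x ≤? r
  ... | yes refl | no r'≰r = contradiction r'≤r r'≰r
  ... | yes refl | yes x≤r
    rewrite dec-true (x ≟ r') refl | dec-true (x ≤? r) x≤r | hole = ≤-refl
  ... | no x≢r'  | yes x≤r
    rewrite dec-false (x ≟ r') x≢r' | dec-true (x ≤? r) x≤r =
      ≤-trans (≤-reflexive (+-identityʳ _)) (𝟙≤1 _)
  ... | no x≢r'  | no x≰r
    rewrite dec-false (x ≟ r') x≢r' | dec-false (x ≤? r) x≰r | top (≰⇒> x≰r) = z≤n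

record _⊑_ (E A : Diagram) : Set where
  field
    columnSize-≡ : ∀ c → columnSize E c ≡ columnSize A c
    reaches-⊆    : ∀ {x c} → Reaches E x c → Reaches A x c
open _⊑_

≈⇒⊑ : ∀ {D E} → D ≈ E → D ⊑ E
≈⇒⊑ {D} {E} D≈E = record
  { columnSize-≡ = λ c → begin
      columnSize D c                   ≡⟨ columnSize-extend D c (m≤m+n _ (bound E)) ⟨
      ∑[ i < K ] 𝟙 (cell D (suc i) c) ≡⟨ ∑-cong K (λ i _ → cong 𝟙 (D≈E (suc i) c)) ⟩
      ∑[ i < K ] 𝟙 (cell E (suc i) c) ≡⟨ columnSize-extend E c (m≤n+m _ (bound D)) ⟩
      columnSize E c                   ∎
  ; reaches-⊆    = λ { {x} {c} (y , x≤y , y∈D) → y , x≤y , trans (sym (D≈E y c)) y∈D }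
  }
  where
  open ≡-Reasoning
  K = bound D + bound E

⊑-trans : ∀ {E B A} → E ⊑ B → B ⊑ A → E ⊑ A
⊑-trans E⊑B B⊑A = record
  { columnSize-≡ = λ c → trans (columnSize-≡ E⊑B c) (columnSize-≡ B⊑A c)
  ; reaches-⊆    = reaches-⊆ B⊑A ∘ reaches-⊆ E⊑B
  }

count-cells-⊑ : ∀ {E A K} → E ⊑ A → bound E ≤ K → bound A ≤ K →
  count K (cell E) ≡ count K (cell A)
count-cells-⊑ {E} {A} {K} E⊑A E≤K A≤K = begin
  count K (cell E)                ≡⟨ count-cells E E≤K ⟩
  ∑[ j < K ] columnSize E (suc j) ≡⟨ ∑-cong K (λ j _ → columnSize-≡ E⊑A (suc j)) ⟩
  ∑[ j < K ] columnSize A (suc j) ≡⟨ count-cells A A≤K ⟨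
  count K (cell A)                ∎
  where open ≡-Reasoning

emptyCount-mono : ∀ {E A} → E ⊑ A → emptyCount E ≤ emptyCount A
emptyCount-mono {E} {A} E⊑A = +-cancelʳ-≤ (count K (cell A)) _ _ (begin
  emptyCount E + count K (cell A) ≡⟨ cong (emptyCount E +_) (count-cells-⊑ E⊑A E≤K A≤K) ⟨
  emptyCount E + count K (cell E) ≡⟨ emptyCount-+-cells E E≤K ⟩
  count K (reaches? E)            ≤⟨ count-mono K {reaches? E} {reaches? A} reaches-E⇒A ⟩
  count K (reaches? A)            ≡⟨ emptyCount-+-cells A A≤K ⟨
  emptyCount A + count K (cell A) ∎)
  where
  open ≤-Reasoning
  K = bound E + bound A
  E≤K = m≤m+n (bound E) (bound A)
  A≤K = m≤n+m (bound A) (bound E)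
  reaches-E⇒A : ∀ {x c} → reaches? E x c ≡ true → reaches? A x c ≡ true
  reaches-E⇒A {x} {c} = reaches?-complete A ∘ reaches-⊆ E⊑A ∘ reaches?-sound E x c

-- Kohnert moves

movedCell-true : ∀ A {r c r'} x y → movedCell A r c r' x y ≡ true →
  (x ≡ r' × y ≡ c) ⊎ cell A x y ≡ true
movedCell-true A {r} {c} {r'} x y e with ⌊ x ≟ r ⌋ ∧ ⌊ y ≟ c ⌋
... | true  = contradiction e λ ()
... | false with x ≟ r' | y ≟ c
...   | yes x≡r' | yes y≡c = inj₁ (x≡r' , y≡c)
...   | yes _    | no _    = inj₂ e
...   | no _     | _       = inj₂ e

moved : (A : Diagram) {r c r' : ℕ} → NontrivialAt A r c r' → Diagram
moved A {r} {c} {r'} (rc∈A , _ , 1≤r' , r'<r , _) = record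
  { cell    = movedCell A r c r'
  ; bound   = bound A
  ; bounded = λ x y e → case movedCell-true A x y e of λ where
      (inj₁ (refl , refl)) →
        (1≤r' , ≤-trans (<⇒≤ r'<r) (row≤bound A rc∈A)) , proj₂ (bounded A r c rc∈A)
      (inj₂ xy∈A) → bounded A x y xy∈A
  }

module KohnertMove (A A' : Diagram) {r c r' : ℕ} (nt : NontrivialAt A r c r')
                 (A'≡ : ∀ x y → cell A' x y ≡ movedCell A r c r' x y) where
  private
    rc∈A : cell A r c ≡ true
    rc∈A = proj₁ nt
    1≤r' : 1 ≤ r'
    1≤r' = proj₁ (proj₂ (proj₂ nt))
    r'<r : r' < r
    r'<r = proj₁ (proj₂ (proj₂ (proj₂ nt)))
    hole : cell A r' c ≡ false
    hole = proj₁ (proj₂ (proj₂ (proj₂ (proj₂ nt))))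
    filled : ∀ x → r' < x → x < r → cell A x c ≡ true
    filled = proj₂ (proj₂ (proj₂ (proj₂ (proj₂ nt))))

    K : ℕ
    K = bound A + bound A'
    A≤K : bound A ≤ K
    A≤K = m≤m+n (bound A) (bound A')
    A'≤K : bound A' ≤ K
    A'≤K = m≤n+m (bound A') (bound A)
    1≤r : 1 ≤ r
    1≤r = ≤-trans (s≤s z≤n) r'<r
    r≤K : r ≤ K
    r≤K = ≤-trans (row≤bound A rc∈A) A≤K

  A'-source : cell A' r c ≡ false
  A'-source rewrite A'≡ r c with r ≟ r | c ≟ c
  ... | yes _  | yes _  = refl
  ... | no r≢r | _      = contradiction refl r≢r
  ... | yes _  | no c≢c = contradiction refl c≢c

  A'-target : cell A' r' c ≡ true
  A'-target rewrite A'≡ r' c with r' ≟ r | c ≟ c | r' ≟ r'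
  ... | yes r'≡r | _      | _        = contradiction r'≡r (<⇒≢ r'<r)
  ... | no _     | yes _  | yes _    = refl
  ... | no _     | no c≢c | _        = contradiction refl c≢c
  ... | no _     | yes _  | no r'≢r' = contradiction refl r'≢r'

  A'-elsewhere : ∀ {x y} → ¬ (x ≡ r × y ≡ c) → ¬ (x ≡ r' × y ≡ c) → cell A' x y ≡ cell A x y
  A'-elsewhere {x} {y} ¬src ¬tgt rewrite A'≡ x y with x ≟ r | y ≟ c | x ≟ r'
  ... | yes x≡r | yes y≡c | _        = contradiction (x≡r , y≡c) ¬src
  ... | no _    | yes y≡c | yes x≡r' = contradiction (x≡r' , y≡c) ¬tgt
  ... | yes _   | no _    | yes _    = refl
  ... | yes _   | no _    | no _     = refl
  ... | no _    | no _    | yes _    = refl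
  ... | no _    | _       | no _     = refl

  A'-cell : ∀ {x y} → cell A' x y ≡ true → (x ≡ r' × y ≡ c) ⊎ cell A x y ≡ true
  A'-cell {x} {y} e = movedCell-true A x y (trans (sym (A'≡ x y)) e)

  column-balance : ∀ x →
    𝟙 (cell A' x c) + 𝟙 (does (x ≟ r)) ≡ 𝟙 (cell A x c) + 𝟙 (does (x ≟ r'))
  column-balance x with x ≟ r | x ≟ r'
  ... | yes refl | yes r≡r' = contradiction (sym r≡r') (<⇒≢ r'<r)
  ... | yes refl | no r≢r'
    rewrite A'-source | rc∈A | dec-true (r ≟ r) refl | dec-false (r ≟ r') r≢r' = refl
  ... | no r'≢r  | yes refl
    rewrite A'-target | hole | dec-false (r' ≟ r) r'≢r | dec-true (r' ≟ r') refl = refl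
  ... | no x≢r   | no x≢r'
    rewrite A'-elsewhere {x} {c} (x≢r ∘ proj₁) (x≢r' ∘ proj₁)
          | dec-false (x ≟ r) x≢r | dec-false (x ≟ r') x≢r' = refl

  columnSize-moved : ∀ c₀ → columnSize A' c₀ ≡ columnSize A c₀
  columnSize-moved c₀ with c₀ ≟ c
  ... | no c₀≢c = begin
    columnSize A' c₀                   ≡⟨ columnSize-extend A' c₀ A'≤K ⟨
    ∑[ i < K ] 𝟙 (cell A' (suc i) c₀)
      ≡⟨ ∑-cong K (λ i _ → cong 𝟙 (A'-elsewhere (c₀≢c ∘ proj₂) (c₀≢c ∘ proj₂))) ⟩
    ∑[ i < K ] 𝟙 (cell A (suc i) c₀)  ≡⟨ columnSize-extend A c₀ A≤K ⟩
    columnSize A c₀                    ∎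
    where open ≡-Reasoning
  ... | yes refl = +-cancelʳ-≡ 1 _ _ (begin
    columnSize A' c + 1
      ≡⟨ cong₂ _+_ (columnSize-extend A' c A'≤K) (∑-𝟙-≟ 1≤r r≤K) ⟨
    ∑[ i < K ] 𝟙 (cell A' (suc i) c) + ∑[ i < K ] 𝟙 (does (suc i ≟ r))
      ≡⟨ ∑-distrib-+ K (λ i → 𝟙 (cell A' (suc i) c)) _ ⟨
    ∑[ i < K ] (𝟙 (cell A' (suc i) c) + 𝟙 (does (suc i ≟ r)))
      ≡⟨ ∑-cong K (λ i _ → column-balance (suc i)) ⟩
    ∑[ i < K ] (𝟙 (cell A (suc i) c) + 𝟙 (does (suc i ≟ r')))
      ≡⟨ ∑-distrib-+ K (λ i → 𝟙 (cell A (suc i) c)) _ ⟩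
    ∑[ i < K ] 𝟙 (cell A (suc i) c) + ∑[ i < K ] 𝟙 (does (suc i ≟ r'))
      ≡⟨ cong₂ _+_ (columnSize-extend A c A≤K) (∑-𝟙-≟ 1≤r' (≤-trans (<⇒≤ r'<r) r≤K)) ⟩
    columnSize A c + 1 ∎)
    where open ≡-Reasoning

  reaches-back : ∀ {x y} → Reaches A' x y → Reaches A x y
  reaches-back (z , x≤z , z∈A') with A'-cell z∈A'
  ... | inj₁ (refl , refl) = r , ≤-trans x≤z (<⇒≤ r'<r) , rc∈A
  ... | inj₂ z∈A           = z , x≤z , z∈A

  A'⊑A : A' ⊑ A
  A'⊑A = record { columnSize-≡ = columnSize-moved ; reaches-⊆ = reaches-back }

  reaches-forward : ∀ {x y} → ¬ (x ≡ r × y ≡ c) → Reaches A x y → Reaches A' x y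
  reaches-forward {x} {y} ¬src (z , x≤z , z∈A) with y ≟ c
  ... | no y≢c = z , x≤z , trans (A'-elsewhere (y≢c ∘ proj₂) (y≢c ∘ proj₂)) z∈A
  ... | yes refl with z ≟ r | z ≟ r'
  ...   | _        | yes refl = r' , x≤z , A'-target
  ...   | no z≢r   | no z≢r'  = z , x≤z , trans (A'-elsewhere (z≢r ∘ proj₁) (z≢r' ∘ proj₁)) z∈A
  ...   | yes refl | no _ with x ≤? r'
  ...     | yes x≤r' = r' , x≤r' , A'-target
  ...     | no x≰r'  = x , ≤-refl , trans (A'-elsewhere (x≢r ∘ proj₁) (x≰r' ∘ ≤-reflexive ∘ proj₁))
                                          (filled x (≰⇒> x≰r') (≤∧≢⇒< x≤z x≢r))
    where
    x≢r : x ≢ r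
    x≢r x≡r = ¬src (x≡r , refl)

  reaches?-elsewhere : ∀ {x y} → ¬ (x ≡ r × y ≡ c) → reaches? A' x y ≡ reaches? A x y
  reaches?-elsewhere {x} {y} ¬src = ⇔→≡ (mk⇔
    (reaches?-complete A ∘ reaches-back ∘ reaches?-sound A' x y)
    (reaches?-complete A' ∘ reaches-forward ¬src ∘ reaches?-sound A x y))

  SourceOnTop : Set
  SourceOnTop = ∀ {y} → r < y → cell A y c ≡ false

  source-unreached : SourceOnTop → ¬ Reaches A' r c
  source-unreached top (z , r≤z , z∈A') with A'-cell z∈A'
  ... | inj₁ (refl , _) = <⇒≱ r'<r r≤z
  ... | inj₂ z∈A with m≤n⇒m<n∨m≡n r≤z
  ...   | inj₁ r<z  = not-¬ z∈A (top r<z)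
  ...   | inj₂ refl = not-¬ z∈A' A'-source

  height-split : ∀ x y → 𝟙 (reaches? A x y) ≤ 𝟙 (reaches? A' x y) + 𝟙 (isCell r c x y)
  height-split x y with x ≟ r ×-dec y ≟ c
  ... | yes (refl , refl) rewrite isCell-self r c = ≤-trans (𝟙≤1 _) (m≤n+m 1 _)
  ... | no ¬src rewrite isCell-elsewhere ¬src | reaches?-elsewhere ¬src = m≤m+n _ 0

  height-split-top : SourceOnTop →
    ∀ x y → 𝟙 (reaches? A' x y) + 𝟙 (isCell r c x y) ≡ 𝟙 (reaches? A x y)
  height-split-top top x y with x ≟ r ×-dec y ≟ c
  ... | yes (refl , refl)
    rewrite isCell-self r c | reaches?-complete A (r , ≤-refl , rc∈A)
          | 𝟙-false (source-unreached top ∘ reaches?-sound A' r c) = refl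
  ... | no ¬src rewrite isCell-elsewhere ¬src | reaches?-elsewhere ¬src = +-identityʳ _

  private
    emptyCount-target : count K (reaches? A') + 1 ≡ suc (emptyCount A') + count K (cell A)
    emptyCount-target = begin
      count K (reaches? A') + 1
        ≡⟨ cong (_+ 1) (emptyCount-+-cells A' A'≤K) ⟨
      emptyCount A' + count K (cell A') + 1
        ≡⟨ cong (λ n → emptyCount A' + n + 1) (count-cells-⊑ A'⊑A A'≤K A≤K) ⟩
      emptyCount A' + count K (cell A) + 1
        ≡⟨ +-comm _ 1 ⟩
      suc (emptyCount A') + count K (cell A) ∎
      where open ≡-Reasoning

  emptyCount-≤ : emptyCount A ≤ suc (emptyCount A')
  emptyCount-≤ = +-cancelʳ-≤ (count K (cell A)) _ _ (begin
    emptyCount A + count K (cell A)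
      ≡⟨ emptyCount-+-cells A A≤K ⟩
    count K (reaches? A)
      ≤⟨ count-≤-+ K {reaches? A'} {isCell r c} height-split ⟩
    count K (reaches? A') + count K (isCell r c)
      ≤⟨ +-monoʳ-≤ _ (count-isCell-≤ K r c) ⟩
    count K (reaches? A') + 1
      ≡⟨ emptyCount-target ⟩
    suc (emptyCount A') + count K (cell A) ∎)
    where open ≤-Reasoning

  emptyCount-top : SourceOnTop → emptyCount A ≡ suc (emptyCount A')
  emptyCount-top top = +-cancelʳ-≡ (count K (cell A)) _ _ (begin
    emptyCount A + count K (cell A)
      ≡⟨ emptyCount-+-cells A A≤K ⟩
    count K (reaches? A)
      ≡⟨ count-merge K {reaches? A'} {isCell r c} (height-split-top top) ⟨
    count K (reaches? A') + count K (isCell r c)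
      ≡⟨ cong (count K (reaches? A') +_) (count-isCell-≡ 1≤r r≤K (1≤col A rc∈A) c≤K) ⟩
    count K (reaches? A') + 1
      ≡⟨ emptyCount-target ⟩
    suc (emptyCount A') + count K (cell A) ∎)
    where
    open ≡-Reasoning
    c≤K = ≤-trans (col≤bound A rc∈A) A≤K

steps-⊑ : ∀ {A E k} → Steps A E k → E ⊑ A
steps-⊑ (done A≈E) = ≈⇒⊑ (λ x y → sym (A≈E x y))
steps-⊑ {A} (step {E = A'} _ (_ , _ , nt , A'≡) st) =
  ⊑-trans (steps-⊑ st) (KohnertMove.A'⊑A A A' nt A'≡)

emptyCount-steps : ∀ {A E k} → Steps A E k → emptyCount A ≤ k + emptyCount E
emptyCount-steps {A} {E} (done A≈E) = emptyCount-mono (≈⇒⊑ {A} {E} A≈E)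
emptyCount-steps {A} (step {E = A'} _ (_ , _ , nt , A'≡) st) =
  ≤-trans (KohnertMove.emptyCount-≤ A A' nt A'≡) (s≤s (emptyCount-steps st))

-- Highest moves and the greedy run

lastOrNone : ∀ {P : ℕ → Set} → Decidable P → ∀ N → (∀ {y} → N < y → ¬ P y) →
  (∀ y → ¬ P y) ⊎ ∃ λ m → P m × (∀ {y} → m < y → ¬ P y)
lastOrNone P? zero beyond with P? 0
... | yes p0 = inj₂ (0 , p0 , beyond)
... | no ¬p0 = inj₁ λ where
  zero    → ¬p0
  (suc y) → beyond z<s
lastOrNone P? (suc N) beyond with P? (suc N)
... | yes pN = inj₂ (suc N , pN , beyond)
... | no ¬pN = lastOrNone P? N λ N<y → [ beyond , (λ { refl → ¬pN }) ]′ (m≤n⇒m<n∨m≡n N<y)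

fullOrLastGap : ∀ {P : ℕ → Set} → Decidable P → ∀ u →
    (∀ {x} → 1 ≤ x → x < u → P x)
  ⊎ ∃ λ x → 1 ≤ x × x < u × ¬ P x × (∀ z → x < z → z < u → P z)
fullOrLastGap P? zero          = inj₁ λ _ ()
fullOrLastGap P? (suc zero)    = inj₁ λ 1≤x x<1 → contradiction 1≤x (<⇒≱ x<1)
fullOrLastGap P? (suc (suc v)) with P? (suc v) | fullOrLastGap P? (suc v)
... | no ¬pv | _ =
  inj₂ (suc v , s≤s z≤n , ≤-refl , ¬pv , λ z v<z z<u → contradiction (≤-pred z<u) (<⇒≱ v<z))
... | yes pv | inj₁ full =
  inj₁ λ 1≤x x<u → [ full 1≤x , (λ { refl → pv }) ]′ (m<1+n⇒m<n∨m≡n x<u)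
... | yes pv | inj₂ (x , 1≤x , x<v , ¬px , filled) =
  inj₂ (x , 1≤x , m<n⇒m<1+n x<v , ¬px , λ z x<z z<u →
    [ filled z x<z , (λ { refl → pv }) ]′ (m<1+n⇒m<n∨m≡n z<u))

Movable : Diagram → ℕ → Set
Movable A u = ∃₂ λ c r' → NontrivialAt A u c r'

fixed⇒¬movable : ∀ {A} → Fixed A → ∀ {u} → ¬ Movable A u
fixed⇒¬movable fixed {u} (c , r' , nt) = fixed u c r' nt

Rightmost : Diagram → ℕ → ℕ → Set
Rightmost A u m = cell A u m ≡ true × (∀ c' → m < c' → cell A u c' ≡ false)

rightmost-unique : ∀ {A u m m'} → Rightmost A u m → Rightmost A u m' → m ≡ m'
rightmost-unique {m = m} {m'} (m∈A , right) (m'∈A , right') with <-cmp m m'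
... | tri< m<m' _ _ = contradiction (right _ m<m') (not-¬ m'∈A)
... | tri≈ _ m≡m' _ = m≡m'
... | tri> _ _ m'<m = contradiction (right' _ m'<m) (not-¬ m∈A)

rightmost? : ∀ A u → (∀ c → cell A u c ≢ true) ⊎ ∃ (Rightmost A u)
rightmost? A u
  with lastOrNone (λ c → cell A u c Data.Bool.≟ true) (bound A) (λ N<c e → <⇒≱ N<c (col≤bound A e))
... | inj₁ none              = inj₁ none
... | inj₂ (m , m∈A , right) = inj₂ (m , m∈A , λ c m<c → ¬-not (right m<c))

rightmostOf : ∀ A {u c} → cell A u c ≡ true → ∃ λ m → Rightmost A u m × c ≤ m
rightmostOf A {u} {c} c∈A with rightmost? A u
... | inj₁ none                 = contradiction c∈A (none c)
... | inj₂ (m , rm@(_ , right)) = m , rm , ≮⇒≥ (λ m<c → not-¬ c∈A (right c m<c))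

column-gap : ∀ A {m} u →
    (∀ {x} → 1 ≤ x → x < u → cell A x m ≡ true)
  ⊎ ∃ λ x → 1 ≤ x × x < u × cell A x m ≡ false × (∀ z → x < z → z < u → cell A z m ≡ true)
column-gap A {m} u with fullOrLastGap (λ x → cell A x m Data.Bool.≟ true) u
... | inj₁ full                           = inj₁ full
... | inj₂ (x , 1≤x , x<u , gap , filled) = inj₂ (x , 1≤x , x<u , ¬-not gap , filled)

stuck-column-full : ∀ A {u m} → ¬ Movable A u → Rightmost A u m →
  ∀ {x} → 1 ≤ x → x ≤ u → cell A x m ≡ true
stuck-column-full A {u} {m} stuck (m∈A , right) {x} 1≤x x≤u
  with column-gap A u | m≤n⇒m<n∨m≡n x≤u
... | _              | inj₂ refl = m∈A
... | inj₁ full      | inj₁ x<u  = full 1≤x x<u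
... | inj₂ (x , gap) | inj₁ _    = contradiction (m , x , m∈A , right , gap) stuck

movable⇒gap : ∀ {A u m} → Rightmost A u m → Movable A u →
  ¬ (∀ {x} → 1 ≤ x → x < u → cell A x m ≡ true)
movable⇒gap {A} {u} rm (c , r' , c∈A , right , 1≤r' , r'<u , hole , _) full
  with refl ← rightmost-unique {A} {u} (c∈A , right) rm = not-¬ (full 1≤r' r'<u) hole

movable? : ∀ A → Decidable (Movable A)
movable? A u with rightmost? A u
... | inj₁ none = no λ (c , _ , c∈A , _) → none c c∈A
... | inj₂ (m , rm) with column-gap A {m} u
...   | inj₁ full      = no λ mov → movable⇒gap {A} {u} rm mov full
...   | inj₂ (x , gap) = yes (m , x , proj₁ rm , proj₂ rm , gap)

HighestMove : Diagram → ℕ → ℕ → ℕ → Set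
HighestMove A r c r' = NontrivialAt A r c r' × (∀ {s} → r < s → ¬ Movable A s)

highestMove : ∀ A → Fixed A ⊎ ∃₂ λ r c → ∃ (HighestMove A r c)
highestMove A
  with lastOrNone (movable? A) (bound A) (λ N<s (_ , _ , nt) → <⇒≱ N<s (row≤bound A (proj₁ nt)))
... | inj₁ none                        = inj₁ λ r c r' nt → none r (c , r' , nt)
... | inj₂ (r , (c , r' , nt) , above) = inj₂ (r , c , r' , nt , above)

-- Rows above r admit only trivial moves, so each column is full below the rightmost
-- cell of such a row: a cell at (y, c'') would put a cell right of c in row r, or fill
-- the hole at (r', c).
highestMove-above-empty : ∀ A {r c r'} → HighestMove A r c r' →
  ∀ {y c''} → r < y → c ≤ c'' → cell A y c'' ≡ false
highestMove-above-empty A ((_ , right , 1≤r' , r'<r , hole , _) , above) r<y c≤c'' = ¬-not λ y∈A →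
  let m , rm , c''≤m = rightmostOf A y∈A
      full = stuck-column-full A (above r<y) rm
  in case m≤n⇒m<n∨m≡n (≤-trans c≤c'' c''≤m) of λ where
       (inj₁ c<m)  → not-¬ (full (≤-trans (s≤s z≤n) r'<r) (<⇒≤ r<y)) (right _ c<m)
       (inj₂ refl) → not-¬ (full 1≤r' (<⇒≤ (<-trans r'<r r<y))) hole

emptyCount-highestMove : ∀ A {r c r'} (hm : HighestMove A r c r') →
  emptyCount A ≡ suc (emptyCount (moved A (proj₁ hm)))
emptyCount-highestMove A hm@(nt , _) = KohnertMove.emptyCount-top A (moved A nt) nt (λ _ _ → refl)
  (λ r<y → highestMove-above-empty A hm r<y ≤-refl)

⊑-highestMove : ∀ {E A A' r c r'} → Fixed E → E ⊑ A → (hm : HighestMove A r c r') →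
  (∀ x y → cell A' x y ≡ movedCell A r c r' x y) → E ⊑ A'
⊑-highestMove {E} {A} {A'} {r} {c} fixedE E⊑A hm@(nt@(_ , right , 1≤r' , r'<r , hole , _) , _) A'≡ =
  record
  { columnSize-≡ = λ c₀ → trans (columnSize-≡ E⊑A c₀) (sym (columnSize-moved c₀))
  ; reaches-⊆    = reaches-E⇒A'
  }
  where
  open KohnertMove A A' nt A'≡

  top : SourceOnTop
  top r<y = highestMove-above-empty A hm r<y ≤-refl

  E-below-source : ∀ {y} → cell E y c ≡ true → y ≤ r
  E-below-source {y} y∈E with z , y≤z , z∈A ← reaches-⊆ E⊑A (y , ≤-refl , y∈E) =
    ≤-trans y≤z (≮⇒≥ λ r<z → not-¬ z∈A (top r<z))

  -- Take the rightmost cell (r, m) of row r in E, so c ≤ m. If m = c, column c of the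
  -- fixed diagram E is full up to row r, which is more cells than column c of A has.
  E-source : cell E r c ≡ false
  E-source = ¬-not λ rc∈E → no-rightmost (rightmostOf E rc∈E)
    where
    no-rightmost : ¬ ∃ λ m → Rightmost E r m × c ≤ m
    no-rightmost (m , rm , c≤m) with m≤n⇒m<n∨m≡n c≤m
    ... | inj₂ refl = <⇒≱ (columnSize<r A top 1≤r' (<⇒≤ r'<r) hole)
                          (subst (r ≤_) (columnSize-≡ E⊑A c) (r≤columnSize E column-full))
      where
      column-full : ∀ {x} → 1 ≤ x → x ≤ r → cell E x c ≡ true
      column-full = stuck-column-full E (fixed⇒¬movable {E} fixedE) rm
    ... | inj₁ c<m
      with u , r≤u , u∈A ← reaches-⊆ E⊑A (r , ≤-refl , proj₁ rm) | m≤n⇒m<n∨m≡n r≤u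
    ...   | inj₁ r<u  = not-¬ u∈A (highestMove-above-empty A hm r<u (<⇒≤ c<m))
    ...   | inj₂ refl = not-¬ u∈A (right _ c<m)

  reaches-E⇒A' : ∀ {x c₀} → Reaches E x c₀ → Reaches A' x c₀
  reaches-E⇒A' {x} {c₀} (y , x≤y , y∈E) with x ≟ r ×-dec c₀ ≟ c
  ... | no ¬src           = reaches-forward ¬src (reaches-⊆ E⊑A (y , x≤y , y∈E))
  ... | yes (refl , refl) = contradiction
    (subst (λ z → cell E z c ≡ false) (≤-antisym x≤y (E-below-source y∈E)) E-source) (not-¬ y∈E)

record GreedyRun (A : Diagram) : Set where
  field
    target           : Diagram
    moves            : ℕ
    target-fixed     : Fixed target
    run              : Steps A target moves
    moves+emptyCount : moves + emptyCount target ≡ emptyCount A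
    dominates        : ∀ {E} → Fixed E → E ⊑ A → E ⊑ target

greedy-stop : ∀ {A} → Fixed A → GreedyRun A
greedy-stop {A} fixed = record
  { target           = A
  ; moves            = 0
  ; target-fixed     = fixed
  ; run              = done (λ _ _ → refl)
  ; moves+emptyCount = refl
  ; dominates        = λ _ E⊑A → E⊑A
  }

greedy-step : ∀ {A r c r'} (hm : HighestMove A r c r') → GreedyRun (moved A (proj₁ hm)) → GreedyRun A
greedy-step {A} {r} {c} {r'} hm@(nt , _) g = record
  { target           = target
  ; moves            = suc moves
  ; target-fixed     = target-fixed
  ; run              = step r (c , r' , nt , λ _ _ → refl) run
  ; moves+emptyCount = trans (cong suc moves+emptyCount) (sym (emptyCount-highestMove A hm))
  ; dominates        = λ fixedE E⊑A → dominates fixedE (⊑-highestMove fixedE E⊑A hm (λ _ _ → refl))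
  }
  where open GreedyRun g

greedyRun : ∀ n A → emptyCount A ≡ n → GreedyRun A
greedyRun n       A _    with highestMove A
greedyRun n       A _    | inj₁ fixed            = greedy-stop fixed
greedyRun zero    A ec≡0 | inj₂ (_ , _ , _ , hm) =
  contradiction (trans (sym ec≡0) (emptyCount-highestMove A hm)) 0≢1+n
greedyRun (suc n) A ec≡  | inj₂ (_ , _ , _ , hm) =
  greedy-step hm (greedyRun n _ (suc-injective (trans (sym (emptyCount-highestMove A hm)) ec≡)))

theorem4p8 : (D : Diagram) →
    ∃₂ λ (m M : ℕ) → IsMC D m × IsMaxEmptyMin D M × m + M ≡ emptyCount D
theorem4p8 D = moves , emptyCount target
             , ((target , target-fixed , run) , fewest-moves)
             , ((target , ((moves , run) , target-fixed) , refl) , most-empty)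
             , moves+emptyCount
  where
  open GreedyRun (greedyRun _ D refl)

  most-empty : ∀ E → InMin D E → emptyCount E ≤ emptyCount target
  most-empty E ((_ , st) , fixedE) = emptyCount-mono (dominates fixedE (steps-⊑ st))

  fewest-moves : ∀ E k → Fixed E → Steps D E k → moves ≤ k
  fewest-moves E k fixedE st = +-cancelʳ-≤ (emptyCount target) moves k (begin
    moves + emptyCount target ≡⟨ moves+emptyCount ⟩
    emptyCount D              ≤⟨ emptyCount-steps st ⟩
    k + emptyCount E          ≤⟨ +-monoʳ-≤ k (most-empty E ((k , st) , fixedE)) ⟩
    k + emptyCount target     ∎)
    where open ≤-Reasoning
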